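{- Let $n\ge1$. (a) The number of $2$-Motzkin paths of length $n$ having no broken step at height $0$ is the Catalan number $C_n$. (b) The number of $2$-Motzkin paths of length $n$ having no horizontal (solid or broken) step at height $0$ is the Fine number $F_n$. (c) For $0\le k\le n$, the number of $2$-Motzkin paths of length $n$ having no broken step at height $0$ and exactly $k$ solid steps at height $0$ equals \[m_{n,k}=\sum_{i=0}^{n-k}(-1)^i\left(\frac{k+1+i}{n+1}\right)\binom{2n-k-i}{n}\binom{k+i}{k}.\]
   Context: A $2$-Motzkin path of length $n$ is a lattice path from $(0,0)$ to $(n,0)$ never going below the $x$-axis, each step being an up-step $[1,1]$, a down-step $[1,-1]$, or one of two distinguishable kinds of horizontal step $[1,0]$, called solid and broken. The height of a step is the ordinate of its starting point. $C_m=\frac{1}{m+1}\binom{2m}{m}$ is the Catalan number, and the Fine numbers are defined by $F_0=1$ and $F_{m-1}+2F_m=C_m$ for $m\ge1$. -}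

module Defs where

open import Data.Nat using (ℕ; zero; suc; _+_; _*_; _∸_; _≤_)
open import Data.Nat.DivMod using (_/_)
open import Data.Nat.Combinatorics using (_C_)
open import Data.Bool using (Bool; true; false; _∧_; not)
open import Data.List using (List; []; _∷_; length; filter; concatMap; map)
open import Data.Integer as ℤ using (ℤ; +_)
open import Data.Rational as ℚ using (ℚ)
open import Relation.Nullary.Decidable using (Dec; yes; no)
open import Relation.Unary using (Pred)
open import Relation.Binary.PropositionalEquality using (_≡_)

-- Steps of a 2-Motzkin path: up [1,1], down [1,-1],
-- solid horizontal [1,0] and broken horizontal [1,0].
data Step : Set where
  U D S B : Step

allSteps : List Step
allSteps = U ∷ D ∷ S ∷ B ∷ []

words : ℕ → List (List Step)
words zero    = [] ∷ []
words (suc n) = concatMap (λ s → map (s ∷_) (words n)) allSteps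

isMotzkinFrom : ℕ → List Step → Bool
isMotzkinFrom zero    []      = true
isMotzkinFrom (suc h) []      = false
isMotzkinFrom h       (U ∷ w) = isMotzkinFrom (suc h) w
isMotzkinFrom zero    (D ∷ w) = false
isMotzkinFrom (suc h) (D ∷ w) = isMotzkinFrom h w
isMotzkinFrom h       (S ∷ w) = isMotzkinFrom h w
isMotzkinFrom h       (B ∷ w) = isMotzkinFrom h w

is2Motzkin : List Step → Bool
is2Motzkin = isMotzkinFrom 0

-- Height of a step = ordinate of its starting point.
-- solidAt0From h w / brokenAt0From h w : number of solid / broken steps of w
-- at height 0, when w starts at height h.
solidAt0From : ℕ → List Step → ℕ
solidAt0From h       []      = 0
solidAt0From h       (U ∷ w) = solidAt0From (suc h) w
solidAt0From h       (D ∷ w) = solidAt0From (h ∸ 1) w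
solidAt0From zero    (S ∷ w) = suc (solidAt0From zero w)
solidAt0From (suc h) (S ∷ w) = solidAt0From (suc h) w
solidAt0From h       (B ∷ w) = solidAt0From h w

brokenAt0From : ℕ → List Step → ℕ
brokenAt0From h       []      = 0
brokenAt0From h       (U ∷ w) = brokenAt0From (suc h) w
brokenAt0From h       (D ∷ w) = brokenAt0From (h ∸ 1) w
brokenAt0From h       (S ∷ w) = brokenAt0From h w
brokenAt0From zero    (B ∷ w) = suc (brokenAt0From zero w)
brokenAt0From (suc h) (B ∷ w) = brokenAt0From (suc h) w

solidAt0 brokenAt0 : List Step → ℕ
solidAt0  = solidAt0From 0
brokenAt0 = brokenAt0From 0

isZero : ℕ → Bool
isZero zero    = true
isZero (suc _) = false

eqℕ : ℕ → ℕ → Bool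
eqℕ zero    zero    = true
eqℕ zero    (suc _) = false
eqℕ (suc _) zero    = false
eqℕ (suc m) (suc n) = eqℕ m n

countWords : ℕ → (List Step → Bool) → ℕ
countWords n p = length (filter (λ w → Data.Bool._≟_ (p w) true) (words n))
  where import Data.Bool

noBroken0 : List Step → Bool
noBroken0 w = is2Motzkin w ∧ isZero (brokenAt0 w)

noHoriz0 : List Step → Bool
noHoriz0 w = is2Motzkin w ∧ isZero (brokenAt0 w) ∧ isZero (solidAt0 w)

noBroken0Solid : ℕ → List Step → Bool
noBroken0Solid k w = noBroken0 w ∧ eqℕ (solidAt0 w) k

-- Catalan number C_m = binom(2m,m)/(m+1) (exact division)
catalan : ℕ → ℕ
catalan m = ((2 * m) C m) / suc m

ℕtoℚ : ℕ → ℚ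
ℕtoℚ a = (+ a) ℚ./ 1

sumℚ : ℕ → (ℕ → ℚ) → ℚ
sumℚ zero    f = f 0
sumℚ (suc N) f = sumℚ N f ℚ.+ f (suc N)

mnk : ℕ → ℕ → ℚ
mnk n k = sumℚ (n ∸ k) λ i →
  ((ℤ.- (+ 1)) ℤ.^ i) ℚ./ 1
    ℚ.* ((+ (k + 1 + i)) ℚ./ suc n)
    ℚ.* ℕtoℚ ((2 * n ∸ k ∸ i) C n)
    ℚ.* ℕtoℚ ((k + i) C k)

-- Classify paths by their first step. The paths from height h with no broken step at height 0
-- and k solid steps there obey a linear recursion in (n, k, h); summing them with weight C(k, s),
-- i.e. marking s of those solid steps, gives counts M(n, s, h) satisfying a Pascal-type recursion
-- that is solved by the ballot numbers C(2n − s, n + h) − C(2n − s, n + h + 1). Hence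
-- (n + 1) M(n, s, 0) = (s + 1) C(2n − s, n): for s = 0 this is the Catalan number of (a), and
-- binomial inversion of k ↦ C(k, s) recovers the counts of (c) from the M(n, s, 0). For (b), the
-- paths from height h with no horizontal step at height 0 satisfy T(n−1, h) + 2 T(n, h) = A(n, h) + E(n, h),
-- where A counts paths as in (a) and E those that touch height 0 only at their end; at h = 0
-- this is F(n−1) + 2 F(n) = C(n), which determines F.

module Submission where

open import Defs
open import Algebra.Bundles using (CommutativeSemiring)
open import Data.Bool using (Bool; true; false; _∧_)
import Data.Bool as Bool
open import Data.Bool.Properties using (∧-zeroʳ; ∧-assoc)
open import Data.Integer as ℤ using (ℤ; +_; 0ℤ; 1ℤ)
import Data.Integer.Properties as ℤ
import Data.Integer.Tactic.RingSolver as ℤ-Solver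
open import Data.List using (List; []; _∷_; _++_; length; filter; map; concatMap)
open import Data.List.Properties using (length-++; filter-++; filter-none; filter-≐)
open import Data.List.Relation.Unary.All using (universal)
open import Data.Nat using (ℕ; zero; suc; _+_; _*_; _∸_; _<_; _≤_; z≤n; s≤s)
open import Data.Nat.Combinatorics using (_C_; nCn≡1; nC1≡n; k>n⇒nCk≡0; nCk≡nC[n∸k]; nCk+nC[k+1]≡[n+1]C[k+1])
open import Data.Nat.DivMod using (_/_; m*n/n≡m)
open import Data.Nat.ListAction using (sum)
open import Data.Nat.Properties
open import Data.Nat.Tactic.RingSolver using (solve-∀)
open import Data.Product using (_×_; _,_; proj₁; proj₂)
open import Data.Rational as ℚ using (ℚ)
import Data.Rational.Properties as ℚ
import Data.Rational.Unnormalised as ℚᵘ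
import Data.Rational.Unnormalised.Properties as ℚᵘ
open import Data.Sum using (inj₁; inj₂)
open import Function using (_∘_)
open import Relation.Binary.Definitions using (tri<; tri≈; tri>)
open import Relation.Binary.PropositionalEquality
open import Relation.Nullary.Negation using (contradiction)

module FiniteSums {c ℓ} (R : CommutativeSemiring c ℓ) where

  private
    module R = CommutativeSemiring R
  open R using (Carrier; _≈_; 0#)
  open import Algebra.Properties.CommutativeSemigroup R.+-commutativeSemigroup using (interchange)
  open import Relation.Binary.Reasoning.Setoid R.setoid

  ∑≤ : ℕ → (ℕ → Carrier) → Carrier
  ∑≤ zero    f = f 0
  ∑≤ (suc N) f = ∑≤ N f R.+ f (suc N)

  ∑≤-cong : ∀ N {f g} → (∀ i → i ≤ N → f i ≈ g i) → ∑≤ N f ≈ ∑≤ N g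
  ∑≤-cong zero    f≈g = f≈g 0 z≤n
  ∑≤-cong (suc N) f≈g = R.+-cong (∑≤-cong N λ i i≤N → f≈g i (m≤n⇒m≤1+n i≤N)) (f≈g (suc N) ≤-refl)

  ∑≤-zero : ∀ N {f} → (∀ i → i ≤ N → f i ≈ 0#) → ∑≤ N f ≈ 0#
  ∑≤-zero zero    f≈0 = f≈0 0 z≤n
  ∑≤-zero (suc N) f≈0 = begin
    ∑≤ N _ R.+ _ ≈⟨ R.+-cong (∑≤-zero N λ i i≤N → f≈0 i (m≤n⇒m≤1+n i≤N)) (f≈0 (suc N) ≤-refl) ⟩
    0# R.+ 0#    ≈⟨ R.+-identityˡ 0# ⟩
    0#           ∎

  ∑≤-distrib-+ : ∀ N f g → ∑≤ N (λ i → f i R.+ g i) ≈ ∑≤ N f R.+ ∑≤ N g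
  ∑≤-distrib-+ zero    f g = R.refl
  ∑≤-distrib-+ (suc N) f g = begin
    ∑≤ N (λ i → f i R.+ g i) R.+ (f (suc N) R.+ g (suc N)) ≈⟨ R.+-congʳ (∑≤-distrib-+ N f g) ⟩
    ∑≤ N f R.+ ∑≤ N g R.+ (f (suc N) R.+ g (suc N))        ≈⟨ interchange _ _ _ _ ⟩
    ∑≤ (suc N) f R.+ ∑≤ (suc N) g                          ∎

  *-distribˡ-∑≤ : ∀ N x f → x R.* ∑≤ N f ≈ ∑≤ N (λ i → x R.* f i)
  *-distribˡ-∑≤ zero    x f = R.refl
  *-distribˡ-∑≤ (suc N) x f = R.trans (R.distribˡ x _ _) (R.+-congʳ (*-distribˡ-∑≤ N x f))

  *-distribʳ-∑≤ : ∀ N x f → ∑≤ N f R.* x ≈ ∑≤ N (λ i → f i R.* x)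
  *-distribʳ-∑≤ N x f = R.trans (R.*-comm _ x) (R.trans (*-distribˡ-∑≤ N x f) (∑≤-cong N λ i _ → R.*-comm x (f i)))

  ∑≤-suc : ∀ N f → ∑≤ (suc N) f ≈ f 0 R.+ ∑≤ N (f ∘ suc)
  ∑≤-suc zero    f = R.refl
  ∑≤-suc (suc N) f = R.trans (R.+-congʳ (∑≤-suc N f)) (R.+-assoc _ _ _)

  ∑≤-comm : ∀ M N (f : ℕ → ℕ → Carrier) →
            ∑≤ M (λ i → ∑≤ N (f i)) ≈ ∑≤ N (λ j → ∑≤ M (λ i → f i j))
  ∑≤-comm zero    N f = R.refl
  ∑≤-comm (suc M) N f = R.trans (R.+-congʳ (∑≤-comm M N f)) (R.sym (∑≤-distrib-+ N _ _))

  ∑≤-select : ∀ N {k f} → k ≤ N → (∀ j → j ≤ N → j ≢ k → f j ≈ 0#) → ∑≤ N f ≈ f k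
  ∑≤-select zero    z≤n  f≈0 = R.refl
  ∑≤-select (suc N) {k} {f} k≤1+N f≈0 with m≤n⇒m<n∨m≡n k≤1+N
  ... | inj₁ (s≤s k≤N) = begin
    ∑≤ N f R.+ f (suc N)
      ≈⟨ R.+-cong (∑≤-select N k≤N λ j j≤N → f≈0 j (m≤n⇒m≤1+n j≤N)) (f≈0 (suc N) ≤-refl (>⇒≢ (s≤s k≤N))) ⟩
    f k R.+ 0#
      ≈⟨ R.+-identityʳ (f k) ⟩
    f k ∎
  ... | inj₂ refl = begin
    ∑≤ N f R.+ f (suc N)
      ≈⟨ R.+-congʳ (∑≤-zero N λ j j≤N → f≈0 j (m≤n⇒m≤1+n j≤N) (<⇒≢ (s≤s j≤N))) ⟩
    0# R.+ f (suc N)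
      ≈⟨ R.+-identityˡ (f (suc N)) ⟩
    f (suc N) ∎

private
  countIn : (List Step → Bool) → List (List Step) → ℕ
  countIn p ws = length (filter (λ w → p w Bool.≟ true) ws)

  countIn-++ : ∀ p xs ys → countIn p (xs ++ ys) ≡ countIn p xs + countIn p ys
  countIn-++ p xs ys = trans (cong length (filter-++ _ xs ys)) (length-++ (filter _ xs))

  countIn-map-∷ : ∀ p s ws → countIn p (map (s ∷_) ws) ≡ countIn (p ∘ (s ∷_)) ws
  countIn-map-∷ p s []       = refl
  countIn-map-∷ p s (w ∷ ws) with p (s ∷ w)
  ... | true  = cong suc (countIn-map-∷ p s ws)
  ... | false = countIn-map-∷ p s ws

  countIn-extensions : ∀ p ss ws →
    countIn p (concatMap (λ s → map (s ∷_) ws) ss) ≡ sum (map (λ s → countIn (p ∘ (s ∷_)) ws) ss)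
  countIn-extensions p []       ws = refl
  countIn-extensions p (s ∷ ss) ws =
    trans (countIn-++ p (map (s ∷_) ws) _) (cong₂ _+_ (countIn-map-∷ p s ws) (countIn-extensions p ss ws))

countWords-suc : ∀ n p → countWords (suc n) p ≡
  countWords n (p ∘ (U ∷_)) + (countWords n (p ∘ (D ∷_)) + (countWords n (p ∘ (S ∷_)) + (countWords n (p ∘ (B ∷_)) + 0)))
countWords-suc n p = countIn-extensions p allSteps (words n)

countWords-cong : ∀ n {p q} → (∀ w → p w ≡ q w) → countWords n p ≡ countWords n q
countWords-cong n p≗q = cong length (filter-≐ _ _ ((λ {w} → trans (sym (p≗q w))) , (λ {w} → trans (p≗q w))) (words n))

countWords-none : ∀ n p → (∀ w → p w ≡ false) → countWords n p ≡ 0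
countWords-none n p none = cong length (filter-none _ (universal (λ w → subst (λ b → b ≢ true) (sym (none w)) λ ()) (words n)))

countWords-suc-U+S : ∀ n p → (∀ w → p (D ∷ w) ≡ false) → (∀ w → p (B ∷ w) ≡ false) →
  countWords (suc n) p ≡ countWords n (p ∘ (U ∷_)) + countWords n (p ∘ (S ∷_))
countWords-suc-U+S n p noD noB = begin
  countWords (suc n) p ≡⟨ countWords-suc n p ⟩
  u + (countWords n (p ∘ (D ∷_)) + (s + (countWords n (p ∘ (B ∷_)) + 0)))
    ≡⟨ cong₂ (λ d b → u + (d + (s + (b + 0)))) (countWords-none n _ noD) (countWords-none n _ noB) ⟩
  u + (s + 0) ≡⟨ cong (λ v → u + v) (+-identityʳ s) ⟩
  u + s ∎
  where
  open ≡-Reasoning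
  u = countWords n (p ∘ (U ∷_))
  s = countWords n (p ∘ (S ∷_))

countWords-suc-U+D+2S : ∀ n p → (∀ w → p (S ∷ w) ≡ p (B ∷ w)) →
  countWords (suc n) p ≡ countWords n (p ∘ (U ∷_)) + countWords n (p ∘ (D ∷_)) + 2 * countWords n (p ∘ (S ∷_))
countWords-suc-U+D+2S n p S≡B = begin
  countWords (suc n) p ≡⟨ countWords-suc n p ⟩
  u + (d + (s + (countWords n (p ∘ (B ∷_)) + 0)))
    ≡⟨ cong (λ b → u + (d + (s + (b + 0)))) (countWords-cong n (sym ∘ S≡B)) ⟩
  u + (d + (s + (s + 0))) ≡⟨ regroup u d s ⟩
  u + d + 2 * s ∎
  where
  open ≡-Reasoning
  u = countWords n (p ∘ (U ∷_))
  d = countWords n (p ∘ (D ∷_))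
  s = countWords n (p ∘ (S ∷_))
  regroup : ∀ u d s → u + (d + (s + (s + 0))) ≡ u + d + 2 * s
  regroup = solve-∀

noBroken0From : ℕ → List Step → Bool
noBroken0From h w = isMotzkinFrom h w ∧ isZero (brokenAt0From h w)

noBroken0SolidFrom : ℕ → ℕ → List Step → Bool
noBroken0SolidFrom k h w = noBroken0From h w ∧ eqℕ (solidAt0From h w) k

solid0Paths : ℕ → ℕ → ℕ → ℕ
solid0Paths zero    k       (suc h) = 0
solid0Paths zero    zero    zero    = 1
solid0Paths zero    (suc k) zero    = 0
solid0Paths (suc n) k       (suc h) = solid0Paths n k (2 + h) + solid0Paths n k h + 2 * solid0Paths n k (1 + h)
solid0Paths (suc n) zero    zero    = solid0Paths n 0 1
solid0Paths (suc n) (suc k) zero    = solid0Paths n (suc k) 1 + solid0Paths n k 0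

noBroken0Paths : ℕ → ℕ → ℕ
noBroken0Paths zero    zero    = 1
noBroken0Paths zero    (suc h) = 0
noBroken0Paths (suc n) zero    = noBroken0Paths n 1 + noBroken0Paths n 0
noBroken0Paths (suc n) (suc h) = noBroken0Paths n (2 + h) + noBroken0Paths n h + 2 * noBroken0Paths n (1 + h)

noBroken0From-B : ∀ w → noBroken0From 0 (B ∷ w) ≡ false
noBroken0From-B w = ∧-zeroʳ (isMotzkinFrom 0 w)

noBroken0SolidFrom-B : ∀ k w → noBroken0SolidFrom k 0 (B ∷ w) ≡ false
noBroken0SolidFrom-B k w = cong (_∧ eqℕ (solidAt0From 0 w) k) (noBroken0From-B w)

countWords-noBroken0SolidFrom : ∀ n k h → countWords n (noBroken0SolidFrom k h) ≡ solid0Paths n k h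
countWords-noBroken0SolidFrom zero    zero    zero    = refl
countWords-noBroken0SolidFrom zero    (suc k) zero    = refl
countWords-noBroken0SolidFrom zero    k       (suc h) = refl
countWords-noBroken0SolidFrom (suc n) zero    zero    = begin
  countWords (suc n) (noBroken0SolidFrom 0 0)
    ≡⟨ countWords-suc-U+S n _ (λ _ → refl) (noBroken0SolidFrom-B _) ⟩
  countWords n (noBroken0SolidFrom 0 1) + countWords n (λ w → noBroken0SolidFrom 0 0 (S ∷ w))
    ≡⟨ cong₂ _+_ (countWords-noBroken0SolidFrom n 0 1) (countWords-none n _ (λ _ → ∧-zeroʳ _)) ⟩
  solid0Paths n 0 1 + 0
    ≡⟨ +-identityʳ _ ⟩
  solid0Paths n 0 1 ∎
  where open ≡-Reasoning
countWords-noBroken0SolidFrom (suc n) (suc k) zero    =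
  trans (countWords-suc-U+S n _ (λ _ → refl) (noBroken0SolidFrom-B _))
        (cong₂ _+_ (countWords-noBroken0SolidFrom n (suc k) 1) (countWords-noBroken0SolidFrom n k 0))
countWords-noBroken0SolidFrom (suc n) k       (suc h) =
  trans (countWords-suc-U+D+2S n _ (λ _ → refl))
        (cong₂ _+_ (cong₂ _+_ (countWords-noBroken0SolidFrom n k (2 + h)) (countWords-noBroken0SolidFrom n k h))
                   (cong (2 *_) (countWords-noBroken0SolidFrom n k (1 + h))))

countWords-noBroken0From : ∀ n h → countWords n (noBroken0From h) ≡ noBroken0Paths n h
countWords-noBroken0From zero    zero    = refl
countWords-noBroken0From zero    (suc h) = refl
countWords-noBroken0From (suc n) zero    =
  trans (countWords-suc-U+S n _ (λ _ → refl) noBroken0From-B)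
        (cong₂ _+_ (countWords-noBroken0From n 1) (countWords-noBroken0From n 0))
countWords-noBroken0From (suc n) (suc h) =
  trans (countWords-suc-U+D+2S n _ (λ _ → refl))
        (cong₂ _+_ (cong₂ _+_ (countWords-noBroken0From n (2 + h)) (countWords-noBroken0From n h))
                   (cong (2 *_) (countWords-noBroken0From n (1 + h))))

noHoriz0≗noBroken0SolidFrom : ∀ w → noHoriz0 w ≡ noBroken0SolidFrom 0 0 w
noHoriz0≗noBroken0SolidFrom w = trans (cong (λ b → is2Motzkin w ∧ isZero (brokenAt0 w) ∧ b) (isZero≡eqℕ0 (solidAt0 w)))
  (sym (∧-assoc (is2Motzkin w) (isZero (brokenAt0 w)) (eqℕ (solidAt0 w) 0)))
  where
  isZero≡eqℕ0 : ∀ m → isZero m ≡ eqℕ m 0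
  isZero≡eqℕ0 zero    = refl
  isZero≡eqℕ0 (suc m) = refl

-- Paths from height h that reach height 0 only at their end.
firstPassagePaths : ℕ → ℕ → ℕ
firstPassagePaths zero    zero    = 1
firstPassagePaths zero    (suc h) = 0
firstPassagePaths (suc n) zero    = 0
firstPassagePaths (suc n) (suc h) = firstPassagePaths n (2 + h) + firstPassagePaths n h + 2 * firstPassagePaths n (1 + h)

firstPassagePaths-adjacent-sum : ∀ n h → firstPassagePaths n (suc h) + firstPassagePaths n h ≡ noBroken0Paths n h
firstPassagePaths-adjacent-sum zero    zero    = refl
firstPassagePaths-adjacent-sum zero    (suc h) = refl
firstPassagePaths-adjacent-sum (suc n) zero    = begin
  E n 2 + E n 0 + 2 * E n 1 + 0 ≡⟨ regroup (E n 2) (E n 1) (E n 0) ⟩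
  (E n 2 + E n 1) + (E n 1 + E n 0) ≡⟨ cong₂ _+_ (firstPassagePaths-adjacent-sum n 1) (firstPassagePaths-adjacent-sum n 0) ⟩
  noBroken0Paths n 1 + noBroken0Paths n 0 ∎
  where
  open ≡-Reasoning
  E = firstPassagePaths
  regroup : ∀ e₂ e₁ e₀ → e₂ + e₀ + 2 * e₁ + 0 ≡ (e₂ + e₁) + (e₁ + e₀)
  regroup = solve-∀
firstPassagePaths-adjacent-sum (suc n) (suc h) = begin
  (E n (3 + h) + E n (1 + h) + 2 * E n (2 + h)) + (E n (2 + h) + E n h + 2 * E n (1 + h))
    ≡⟨ regroup (E n (3 + h)) (E n (2 + h)) (E n (1 + h)) (E n h) ⟩
  (E n (3 + h) + E n (2 + h)) + (E n (1 + h) + E n h) + 2 * (E n (2 + h) + E n (1 + h))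
    ≡⟨ cong₂ _+_ (cong₂ _+_ (firstPassagePaths-adjacent-sum n (2 + h)) (firstPassagePaths-adjacent-sum n h))
                 (cong (2 *_) (firstPassagePaths-adjacent-sum n (1 + h))) ⟩
  noBroken0Paths n (2 + h) + noBroken0Paths n h + 2 * noBroken0Paths n (1 + h) ∎
  where
  open ≡-Reasoning
  E = firstPassagePaths
  regroup : ∀ e₃ e₂ e₁ e₀ →
    (e₃ + e₁ + 2 * e₂) + (e₂ + e₀ + 2 * e₁) ≡ (e₃ + e₂) + (e₁ + e₀) + 2 * (e₂ + e₁)
  regroup = solve-∀

solid0Paths-fineRelation : ∀ n h →
  solid0Paths n 0 h + 2 * solid0Paths (suc n) 0 h ≡ noBroken0Paths (suc n) h + firstPassagePaths (suc n) h
solid0Paths-fineRelation zero    zero          = refl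
solid0Paths-fineRelation zero    (suc zero)    = refl
solid0Paths-fineRelation zero    (suc (suc h)) = refl
solid0Paths-fineRelation (suc n) zero          = begin
  solid0Paths n 0 1 + 2 * solid0Paths (suc n) 0 1
    ≡⟨ solid0Paths-fineRelation n 1 ⟩
  A 1 + firstPassagePaths (suc n) 1
    ≡⟨ cong (λ e → A 1 + e) (trans (sym (+-identityʳ _)) (firstPassagePaths-adjacent-sum (suc n) 0)) ⟩
  A 1 + A 0
    ≡⟨ +-identityʳ _ ⟨
  A 1 + A 0 + 0 ∎
  where
  open ≡-Reasoning
  A = noBroken0Paths (suc n)
solid0Paths-fineRelation (suc n) (suc h)       = begin
  (t (2 + h) + t h + 2 * t (1 + h)) + 2 * (u (2 + h) + u h + 2 * u (1 + h))
    ≡⟨ regroup (t (2 + h)) (t h) (t (1 + h)) (u (2 + h)) (u h) (u (1 + h)) ⟩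
  (t (2 + h) + 2 * u (2 + h)) + (t h + 2 * u h) + 2 * (t (1 + h) + 2 * u (1 + h))
    ≡⟨ cong₂ _+_ (cong₂ _+_ (solid0Paths-fineRelation n (2 + h)) (solid0Paths-fineRelation n h))
                 (cong (2 *_) (solid0Paths-fineRelation n (1 + h))) ⟩
  (A (2 + h) + E (2 + h)) + (A h + E h) + 2 * (A (1 + h) + E (1 + h))
    ≡⟨ regroup′ (A (2 + h)) (A h) (A (1 + h)) (E (2 + h)) (E h) (E (1 + h)) ⟩
  (A (2 + h) + A h + 2 * A (1 + h)) + (E (2 + h) + E h + 2 * E (1 + h)) ∎
  where
  open ≡-Reasoning
  t = solid0Paths n 0
  u = solid0Paths (suc n) 0
  A = noBroken0Paths (suc n)
  E = firstPassagePaths (suc n)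
  regroup : ∀ t₂ t₀ t₁ u₂ u₀ u₁ →
    (t₂ + t₀ + 2 * t₁) + 2 * (u₂ + u₀ + 2 * u₁) ≡ (t₂ + 2 * u₂) + (t₀ + 2 * u₀) + 2 * (t₁ + 2 * u₁)
  regroup = solve-∀
  regroup′ : ∀ a₂ a₀ a₁ e₂ e₀ e₁ →
    (a₂ + e₂) + (a₀ + e₀) + 2 * (a₁ + e₁) ≡ (a₂ + a₀ + 2 * a₁) + (e₂ + e₀ + 2 * e₁)
  regroup′ = solve-∀

recurrence-unique : ∀ (F G : ℕ → ℕ) → F 0 ≡ G 0 →
  (∀ m → F m + 2 * F (suc m) ≡ G m + 2 * G (suc m)) → ∀ n → F n ≡ G n
recurrence-unique F G F0≡G0 step zero    = F0≡G0
recurrence-unique F G F0≡G0 step (suc n) = *-cancelˡ-≡ (F (suc n)) (G (suc n)) 2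
  (+-cancelˡ-≡ (F n) _ _ (trans (step n) (cong (_+ 2 * G (suc n)) (sym (recurrence-unique F G F0≡G0 step n)))))

pascal² : ∀ L j → (2 + L) C (2 + j) ≡ L C j + 2 * (L C (1 + j)) + L C (2 + j)
pascal² L j = begin
  (2 + L) C (2 + j)                                           ≡⟨ pascal (1 + L) (1 + j) ⟨
  (1 + L) C (1 + j) + (1 + L) C (2 + j)                       ≡⟨ cong₂ _+_ (pascal L j) (pascal L (1 + j)) ⟨
  (L C j + L C (1 + j)) + (L C (1 + j) + L C (2 + j))         ≡⟨ regroup (L C j) (L C (1 + j)) (L C (2 + j)) ⟩
  L C j + 2 * (L C (1 + j)) + L C (2 + j)                     ∎
  where
  open ≡-Reasoning
  pascal = nCk+nC[k+1]≡[n+1]C[k+1]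
  regroup : ∀ a b c → (a + b) + (b + c) ≡ a + 2 * b + c
  regroup = solve-∀

central-symmetry : ∀ n → suc (n + n) C n ≡ suc (n + n) C suc n
central-symmetry n = begin
  suc (n + n) C n                 ≡⟨ nCk≡nC[n∸k] (m≤n⇒m≤1+n (m≤m+n n n)) ⟩
  suc (n + n) C (suc (n + n) ∸ n) ≡⟨ cong (λ m → suc (n + n) C (m ∸ n)) (sym (+-suc n n)) ⟩
  suc (n + n) C (n + suc n ∸ n)   ≡⟨ cong (suc (n + n) C_) (m+n∸m≡n n (suc n)) ⟩
  suc (n + n) C suc n             ∎
  where open ≡-Reasoning

absorption : ∀ m k → suc k * (suc m C suc k) ≡ suc m * (m C k)
absorption zero    zero    = refl
absorption zero    (suc k) = *-zeroʳ (2 + k)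
absorption (suc m) zero    = trans (*-identityˡ _) (trans (nC1≡n (2 + m)) (sym (*-identityʳ (2 + m))))
absorption (suc m) (suc k) = begin
  (2 + k) * ((2 + m) C (2 + k))      ≡⟨ cong ((2 + k) *_) (nCk+nC[k+1]≡[n+1]C[k+1] (suc m) (suc k)) ⟨
  (2 + k) * (X + Y)                  ≡⟨ regroup k X Y ⟩
  suc k * X + X + (2 + k) * Y        ≡⟨ cong₂ (λ a b → a + X + b) (absorption m k) (absorption m (suc k)) ⟩
  suc m * (m C k) + X + suc m * (m C suc k) ≡⟨ regroup′ m X (m C k) (m C suc k) ⟩
  suc m * (m C k + m C suc k) + X    ≡⟨ cong (λ c → suc m * c + X) (nCk+nC[k+1]≡[n+1]C[k+1] m k) ⟩
  suc m * X + X                      ≡⟨ regroup″ m X ⟩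
  (2 + m) * X                        ∎
  where
  open ≡-Reasoning
  X = suc m C suc k
  Y = suc m C (2 + k)
  regroup : ∀ k X Y → (2 + k) * (X + Y) ≡ suc k * X + X + (2 + k) * Y
  regroup = solve-∀
  regroup′ : ∀ m X a b → suc m * a + X + suc m * b ≡ suc m * (a + b) + X
  regroup′ = solve-∀
  regroup″ : ∀ m X → suc m * X + X ≡ (2 + m) * X
  regroup″ = solve-∀

absorption-complement : ∀ m k → suc k * ((m + k) C suc k) ≡ m * ((m + k) C k)
absorption-complement m k = +-cancelˡ-≡ (suc k * X) _ _ (begin
  suc k * X + suc k * ((m + k) C suc k) ≡⟨ *-distribˡ-+ (suc k) X _ ⟨
  suc k * (X + (m + k) C suc k)         ≡⟨ cong (suc k *_) (nCk+nC[k+1]≡[n+1]C[k+1] (m + k) k) ⟩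
  suc k * (suc (m + k) C suc k)         ≡⟨ absorption (m + k) k ⟩
  suc (m + k) * X                       ≡⟨ regroup m k X ⟩
  suc k * X + m * X                     ∎)
  where
  open ≡-Reasoning
  X = (m + k) C k
  regroup : ∀ m k X → suc (m + k) * X ≡ suc k * X + m * X
  regroup = solve-∀

trinomial-revision : ∀ k t i → ((k + t) C (k + i)) * ((k + i) C k) ≡ ((k + t) C k) * (t C i)
trinomial-revision zero    t i = trans (*-identityʳ (t C i)) (sym (*-identityˡ (t C i)))
trinomial-revision (suc k) t i = *-cancelˡ-≡ _ _ (suc k) (begin
  suc k * (a * b)        ≡⟨ swap (suc k) a b ⟩
  a * (suc k * b)        ≡⟨ cong (a *_) (absorption (k + i) k) ⟩
  a * (suc (k + i) * d)  ≡⟨ swap′ a (suc (k + i)) d ⟩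
  suc (k + i) * a * d    ≡⟨ cong (_* d) (absorption (k + t) (k + i)) ⟩
  suc (k + t) * e * d    ≡⟨ *-assoc (suc (k + t)) e d ⟩
  suc (k + t) * (e * d)  ≡⟨ cong (suc (k + t) *_) (trinomial-revision k t i) ⟩
  suc (k + t) * (f * g)  ≡⟨ *-assoc (suc (k + t)) f g ⟨
  suc (k + t) * f * g    ≡⟨ cong (_* g) (absorption (k + t) k) ⟨
  suc k * h * g          ≡⟨ *-assoc (suc k) h g ⟩
  suc k * (h * g)        ∎)
  where
  open ≡-Reasoning
  a = (suc k + t) C (suc k + i)
  b = (suc k + i) C suc k
  d = (k + i) C k
  e = (k + t) C (k + i)
  f = (k + t) C k
  g = t C i
  h = (suc k + t) C suc k
  swap : ∀ a b c → a * (b * c) ≡ b * (a * c)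
  swap = solve-∀
  swap′ : ∀ a b c → a * (b * c) ≡ b * a * c
  swap′ = solve-∀

module BinomialInversion where

  open FiniteSums ℤ.+-*-commutativeSemiring

  -1^_ : ℕ → ℤ
  -1^ i = (ℤ.- + 1) ℤ.^ i

  alternatingSum : ℕ → ℕ → ℤ
  alternatingSum t M = ∑≤ M (λ i → -1^ i ℤ.* + (t C i))

  alternatingSum-suc : ∀ t M → alternatingSum (suc t) M ≡ -1^ M ℤ.* + (t C M)
  alternatingSum-suc t zero    = refl
  alternatingSum-suc t (suc M) = begin
    alternatingSum (suc t) M ℤ.+ -1^ suc M ℤ.* + (suc t C suc M)
      ≡⟨ cong₂ ℤ._+_ (alternatingSum-suc t M) (cong (λ c → -1^ suc M ℤ.* + c) (sym (nCk+nC[k+1]≡[n+1]C[k+1] t M))) ⟩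
    -1^ M ℤ.* + (t C M) ℤ.+ -1^ suc M ℤ.* + (t C M + t C suc M)
      ≡⟨ cong (λ c → -1^ M ℤ.* + (t C M) ℤ.+ -1^ suc M ℤ.* c) (ℤ.pos-+ (t C M) (t C suc M)) ⟩
    -1^ M ℤ.* + (t C M) ℤ.+ ℤ.- 1ℤ ℤ.* -1^ M ℤ.* (+ (t C M) ℤ.+ + (t C suc M))
      ≡⟨ telescope (-1^ M) (+ (t C M)) (+ (t C suc M)) ⟩
    -1^ suc M ℤ.* + (t C suc M) ∎
    where
    open ≡-Reasoning
    telescope : ∀ s a b → s ℤ.* a ℤ.+ ℤ.- 1ℤ ℤ.* s ℤ.* (a ℤ.+ b) ≡ ℤ.- 1ℤ ℤ.* s ℤ.* b
    telescope = ℤ-Solver.solve-∀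

  alternatingSum-zero : ∀ M → alternatingSum 0 M ≡ 1ℤ
  alternatingSum-zero zero    = refl
  alternatingSum-zero (suc M) =
    trans (cong₂ ℤ._+_ (alternatingSum-zero M) (ℤ.*-zeroʳ (-1^ suc M))) (ℤ.+-identityʳ 1ℤ)

  pairing : ℕ → ℕ → ℕ → ℤ
  pairing j k M = ∑≤ M (λ i → -1^ i ℤ.* + (j C (k + i)) ℤ.* + ((k + i) C k))

  pairing-+ : ∀ k t M → pairing (k + t) k M ≡ + ((k + t) C k) ℤ.* alternatingSum t M
  pairing-+ k t M = begin
    pairing (k + t) k M
      ≡⟨ ∑≤-cong M (λ i _ → revise i) ⟩
    ∑≤ M (λ i → + ((k + t) C k) ℤ.* (-1^ i ℤ.* + (t C i)))
      ≡⟨ *-distribˡ-∑≤ M (+ ((k + t) C k)) _ ⟨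
    + ((k + t) C k) ℤ.* alternatingSum t M ∎
    where
    open ≡-Reasoning
    swap : ∀ a b c → a ℤ.* (b ℤ.* c) ≡ b ℤ.* (a ℤ.* c)
    swap = ℤ-Solver.solve-∀
    revise : ∀ i → -1^ i ℤ.* + ((k + t) C (k + i)) ℤ.* + ((k + i) C k) ≡ + ((k + t) C k) ℤ.* (-1^ i ℤ.* + (t C i))
    revise i = begin
      -1^ i ℤ.* + e ℤ.* + d    ≡⟨ ℤ.*-assoc (-1^ i) (+ e) (+ d) ⟩
      -1^ i ℤ.* (+ e ℤ.* + d)  ≡⟨ cong (-1^ i ℤ.*_) (ℤ.pos-* e d) ⟨
      -1^ i ℤ.* + (e * d)      ≡⟨ cong (λ c → -1^ i ℤ.* + c) (trinomial-revision k t i) ⟩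
      -1^ i ℤ.* + (f * g)      ≡⟨ cong (-1^ i ℤ.*_) (ℤ.pos-* f g) ⟩
      -1^ i ℤ.* (+ f ℤ.* + g)  ≡⟨ swap (-1^ i) (+ f) (+ g) ⟩
      + f ℤ.* (-1^ i ℤ.* + g)  ∎
      where
      e = (k + t) C (k + i)
      d = (k + i) C k
      f = (k + t) C k
      g = t C i

  pairing-diagonal : ∀ k M → pairing k k M ≡ 1ℤ
  pairing-diagonal k M = begin
    pairing k k M
      ≡⟨ subst (λ j → pairing j k M ≡ + (j C k) ℤ.* alternatingSum 0 M) (+-identityʳ k) (pairing-+ k 0 M) ⟩
    + (k C k) ℤ.* alternatingSum 0 M
      ≡⟨ cong₂ (λ c a → + c ℤ.* a) (nCn≡1 k) (alternatingSum-zero M) ⟩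
    1ℤ ∎
    where open ≡-Reasoning

  pairing-orthogonal : ∀ {j k M} → j ≤ k + M → j ≢ k → pairing j k M ≡ 0ℤ
  pairing-orthogonal {j} {k} {M} j≤k+M j≢k with <-cmp j k
  ... | tri< j<k _ _ = ∑≤-zero M λ i _ → begin
    -1^ i ℤ.* + (j C (k + i)) ℤ.* + ((k + i) C k)
      ≡⟨ cong (λ c → -1^ i ℤ.* + c ℤ.* + ((k + i) C k)) (k>n⇒nCk≡0 (<-≤-trans j<k (m≤m+n k i))) ⟩
    -1^ i ℤ.* 0ℤ ℤ.* + ((k + i) C k)
      ≡⟨ cong (ℤ._* + ((k + i) C k)) (ℤ.*-zeroʳ (-1^ i)) ⟩
    0ℤ ∎
    where open ≡-Reasoning
  ... | tri≈ _ j≡k _ = contradiction j≡k j≢k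
  ... | tri> _ _ k<j with m≤n⇒∃[o]m+o≡n k<j
  ...   | t , refl = begin
    pairing (suc k + t) k M
      ≡⟨ subst (λ j → pairing j k M ≡ + (j C k) ℤ.* alternatingSum (suc t) M) (+-suc k t) (pairing-+ k (suc t) M) ⟩
    c ℤ.* alternatingSum (suc t) M         ≡⟨ cong (c ℤ.*_) (alternatingSum-suc t M) ⟩
    c ℤ.* (-1^ M ℤ.* + (t C M))            ≡⟨ cong (λ b → c ℤ.* (-1^ M ℤ.* + b)) (k>n⇒nCk≡0 t<M) ⟩
    c ℤ.* (-1^ M ℤ.* 0ℤ)                   ≡⟨ trans (cong (c ℤ.*_) (ℤ.*-zeroʳ (-1^ M))) (ℤ.*-zeroʳ c) ⟩
    0ℤ                                     ∎
    where
    open ≡-Reasoning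
    c = + ((suc k + t) C k)
    t<M : t < M
    t<M = +-cancelˡ-≤ k (suc t) M (subst (_≤ k + M) (sym (+-suc k t)) j≤k+M)

  binomial-inversion : ∀ k M (T : ℕ → ℤ) →
    ∑≤ M (λ i → -1^ i ℤ.* ∑≤ (k + M) (λ j → + (j C (k + i)) ℤ.* T j) ℤ.* + ((k + i) C k)) ≡ T k
  binomial-inversion k M T = begin
    ∑≤ M (λ i → -1^ i ℤ.* ∑≤ N (f i) ℤ.* + ((k + i) C k))
      ≡⟨ ∑≤-cong M (λ i _ → expand i) ⟩
    ∑≤ M (λ i → ∑≤ N (λ j → T j ℤ.* w j i))
      ≡⟨ ∑≤-comm M N _ ⟩
    ∑≤ N (λ j → ∑≤ M (λ i → T j ℤ.* w j i))
      ≡⟨ ∑≤-cong N (λ j _ → *-distribˡ-∑≤ M (T j) (w j)) ⟨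
    ∑≤ N (λ j → T j ℤ.* pairing j k M)
      ≡⟨ ∑≤-select N (m≤m+n k M) (λ j j≤N j≢k → trans (cong (T j ℤ.*_) (pairing-orthogonal j≤N j≢k)) (ℤ.*-zeroʳ (T j))) ⟩
    T k ℤ.* pairing k k M
      ≡⟨ trans (cong (T k ℤ.*_) (pairing-diagonal k M)) (ℤ.*-identityʳ (T k)) ⟩
    T k ∎
    where
    open ≡-Reasoning
    N = k + M
    f : ℕ → ℕ → ℤ
    f i j = + (j C (k + i)) ℤ.* T j
    w : ℕ → ℕ → ℤ
    w j i = -1^ i ℤ.* + (j C (k + i)) ℤ.* + ((k + i) C k)
    regroup : ∀ s b t c → s ℤ.* (b ℤ.* t) ℤ.* c ≡ t ℤ.* (s ℤ.* b ℤ.* c)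
    regroup = ℤ-Solver.solve-∀
    expand : ∀ i → -1^ i ℤ.* ∑≤ N (f i) ℤ.* + ((k + i) C k) ≡ ∑≤ N (λ j → T j ℤ.* w j i)
    expand i = begin
      -1^ i ℤ.* ∑≤ N (f i) ℤ.* c          ≡⟨ cong (ℤ._* c) (*-distribˡ-∑≤ N (-1^ i) (f i)) ⟩
      ∑≤ N (λ j → -1^ i ℤ.* f i j) ℤ.* c  ≡⟨ *-distribʳ-∑≤ N c _ ⟩
      ∑≤ N (λ j → -1^ i ℤ.* f i j ℤ.* c)  ≡⟨ ∑≤-cong N (λ j _ → regroup (-1^ i) (+ (j C (k + i))) (T j) c) ⟩
      ∑≤ N (λ j → T j ℤ.* w j i)          ∎
      where c = + ((k + i) C k)

open BinomialInversion using (-1^_; binomial-inversion)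
open FiniteSums +-*-commutativeSemiring
module ℤΣ = FiniteSums ℤ.+-*-commutativeSemiring

solid0Paths-vanish : ∀ {n k} h → n < k → solid0Paths n k h ≡ 0
solid0Paths-vanish {zero}  {k}     (suc h) n<k       = refl
solid0Paths-vanish {zero}  {suc k} zero    n<k       = refl
solid0Paths-vanish {suc n}         (suc h) n<k       =
  cong₂ _+_ (cong₂ _+_ (solid0Paths-vanish (2 + h) n<k′) (solid0Paths-vanish h n<k′))
            (cong (2 *_) (solid0Paths-vanish (1 + h) n<k′))
  where n<k′ = <-trans (n<1+n n) n<k
solid0Paths-vanish {suc n} {suc k} zero    (s≤s n<k) =
  cong₂ _+_ (solid0Paths-vanish 1 (m<n⇒m<1+n n<k)) (solid0Paths-vanish 0 n<k)

-- Paths counted by solid0Paths n k h with s of their k solid height-0 steps marked.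
markedPaths : ℕ → ℕ → ℕ → ℕ
markedPaths n s h = ∑≤ n λ k → (k C s) * solid0Paths n k h

markedPaths-vanish : ∀ {n s} h → n < s → markedPaths n s h ≡ 0
markedPaths-vanish h n<s = ∑≤-zero _ λ k k≤n → cong (_* _) (k>n⇒nCk≡0 (≤-<-trans k≤n n<s))

private
  ∑≤-suc-markedPaths : ∀ n s h → ∑≤ (suc n) (λ k → (k C s) * solid0Paths n k h) ≡ markedPaths n s h
  ∑≤-suc-markedPaths n s h = begin
    markedPaths n s h + (suc n C s) * solid0Paths n (suc n) h
      ≡⟨ cong (λ t → markedPaths n s h + (suc n C s) * t) (solid0Paths-vanish h (n<1+n n)) ⟩
    markedPaths n s h + (suc n C s) * 0
      ≡⟨ cong (λ v → markedPaths n s h + v) (*-zeroʳ (suc n C s)) ⟩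
    markedPaths n s h + 0
      ≡⟨ +-identityʳ _ ⟩
    markedPaths n s h ∎
    where open ≡-Reasoning

markedPaths-suc-suc : ∀ n s h →
  markedPaths (suc n) s (suc h) ≡ markedPaths n s (2 + h) + markedPaths n s h + 2 * markedPaths n s (1 + h)
markedPaths-suc-suc n s h = begin
  ∑≤ (suc n) (λ k → (k C s) * (T k (2 + h) + T k h + 2 * T k (1 + h)))
    ≡⟨ ∑≤-cong (suc n) (λ k _ → distrib (k C s) (T k (2 + h)) (T k h) (T k (1 + h))) ⟩
  ∑≤ (suc n) (λ k → w (2 + h) k + w h k + 2 * w (1 + h) k)
    ≡⟨ ∑≤-distrib-+ (suc n) _ _ ⟩
  ∑≤ (suc n) (λ k → w (2 + h) k + w h k) + ∑≤ (suc n) (λ k → 2 * w (1 + h) k)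
    ≡⟨ cong₂ _+_ (∑≤-distrib-+ (suc n) _ _) (sym (*-distribˡ-∑≤ (suc n) 2 (w (1 + h)))) ⟩
  ∑≤ (suc n) (w (2 + h)) + ∑≤ (suc n) (w h) + 2 * ∑≤ (suc n) (w (1 + h))
    ≡⟨ cong₂ _+_ (cong₂ _+_ (∑≤-suc-markedPaths n s (2 + h)) (∑≤-suc-markedPaths n s h))
                 (cong (2 *_) (∑≤-suc-markedPaths n s (1 + h))) ⟩
  markedPaths n s (2 + h) + markedPaths n s h + 2 * markedPaths n s (1 + h) ∎
  where
  open ≡-Reasoning
  T = solid0Paths n
  w = λ h′ k → (k C s) * T k h′
  distrib : ∀ c a b d → c * (a + b + 2 * d) ≡ c * a + c * b + 2 * (c * d)
  distrib = solve-∀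

private
  markedPaths-suc-zero : ∀ n s →
    markedPaths (suc n) s 0 ≡ markedPaths n s 1 + ∑≤ n (λ k → (suc k C s) * solid0Paths n k 0)
  markedPaths-suc-zero n s = begin
    ∑≤ (suc n) (λ k → (k C s) * solid0Paths (suc n) k 0)
      ≡⟨ ∑≤-suc n _ ⟩
    (0 C s) * T 0 1 + ∑≤ n (λ k → (suc k C s) * (T (suc k) 1 + T k 0))
      ≡⟨ cong (λ v → (0 C s) * T 0 1 + v) (trans (∑≤-cong n λ k _ → *-distribˡ-+ (suc k C s) _ _) (∑≤-distrib-+ n _ _)) ⟩
    (0 C s) * T 0 1 + (∑≤ n (λ k → (suc k C s) * T (suc k) 1) + ∑≤ n (λ k → (suc k C s) * T k 0))
      ≡⟨ +-assoc ((0 C s) * T 0 1) _ _ ⟨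
    (0 C s) * T 0 1 + ∑≤ n (λ k → (suc k C s) * T (suc k) 1) + ∑≤ n (λ k → (suc k C s) * T k 0)
      ≡⟨ cong (_+ ∑≤ n (λ k → (suc k C s) * T k 0)) (trans (sym (∑≤-suc n _)) (∑≤-suc-markedPaths n s 1)) ⟩
    markedPaths n s 1 + ∑≤ n (λ k → (suc k C s) * T k 0) ∎
    where
    open ≡-Reasoning
    T = solid0Paths n

markedPaths-suc-0-0 : ∀ n → markedPaths (suc n) 0 0 ≡ markedPaths n 0 1 + markedPaths n 0 0
markedPaths-suc-0-0 n = markedPaths-suc-zero n 0

markedPaths-suc-suc-0 : ∀ n s →
  markedPaths (suc n) (suc s) 0 ≡ markedPaths n (suc s) 1 + markedPaths n (suc s) 0 + markedPaths n s 0
markedPaths-suc-suc-0 n s = begin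
  markedPaths (suc n) (suc s) 0
    ≡⟨ markedPaths-suc-zero n (suc s) ⟩
  markedPaths n (suc s) 1 + ∑≤ n (λ k → (suc k C suc s) * solid0Paths n k 0)
    ≡⟨ cong (λ v → markedPaths n (suc s) 1 + v) (∑≤-cong n λ k _ → pascal k) ⟩
  markedPaths n (suc s) 1 + ∑≤ n (λ k → (k C suc s) * solid0Paths n k 0 + (k C s) * solid0Paths n k 0)
    ≡⟨ cong (λ v → markedPaths n (suc s) 1 + v) (∑≤-distrib-+ n _ _) ⟩
  markedPaths n (suc s) 1 + (markedPaths n (suc s) 0 + markedPaths n s 0)
    ≡⟨ +-assoc (markedPaths n (suc s) 1) _ _ ⟨
  markedPaths n (suc s) 1 + markedPaths n (suc s) 0 + markedPaths n s 0 ∎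
  where
  open ≡-Reasoning
  pascal : ∀ k → (suc k C suc s) * solid0Paths n k 0 ≡ (k C suc s) * solid0Paths n k 0 + (k C s) * solid0Paths n k 0
  pascal k = trans (cong (_* solid0Paths n k 0) (trans (sym (nCk+nC[k+1]≡[n+1]C[k+1] k s)) (+-comm (k C s) _)))
                   (*-distribʳ-+ (solid0Paths n k 0) (k C suc s) (k C s))

markedPaths-diagonal : ∀ n h → markedPaths n n h ≡ n C (h + n)
markedPaths-diagonal zero    zero    = refl
markedPaths-diagonal zero    (suc h) = refl
markedPaths-diagonal (suc n) zero    = begin
  markedPaths (suc n) (suc n) 0                                              ≡⟨ markedPaths-suc-suc-0 n n ⟩
  markedPaths n (suc n) 1 + markedPaths n (suc n) 0 + markedPaths n n 0
    ≡⟨ cong₂ (λ a b → a + b + markedPaths n n 0) (markedPaths-vanish 1 (n<1+n n)) (markedPaths-vanish 0 (n<1+n n)) ⟩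
  markedPaths n n 0                                                          ≡⟨ markedPaths-diagonal n 0 ⟩
  n C n                                                                      ≡⟨ nCn≡1 n ⟩
  1                                                                          ≡⟨ nCn≡1 (suc n) ⟨
  suc n C suc n                                                              ∎
  where open ≡-Reasoning
markedPaths-diagonal (suc n) (suc h) = begin
  markedPaths (suc n) (suc n) (suc h)                                        ≡⟨ markedPaths-suc-suc n (suc n) h ⟩
  markedPaths n (suc n) (2 + h) + markedPaths n (suc n) h + 2 * markedPaths n (suc n) (1 + h)
    ≡⟨ cong₂ _+_ (cong₂ _+_ (vanish (2 + h)) (vanish h)) (cong (2 *_) (vanish (1 + h))) ⟩
  0                                                                          ≡⟨ k>n⇒nCk≡0 (s≤s (m≤n+m (suc n) h)) ⟨
  suc n C (suc h + suc n)                                                    ∎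
  where
  open ≡-Reasoning
  vanish = λ h′ → markedPaths-vanish h′ (n<1+n n)

-- With n = d + s: markedPaths n s h = C(2n − s, n + h) − C(2n − s, n + h + 1), stated without subtraction.
markedPaths-ballot : ∀ d s h →
  markedPaths (d + s) s h + (d + (d + s)) C suc (h + (d + s)) ≡ (d + (d + s)) C (h + (d + s))
markedPaths-ballot zero s h =
  trans (cong₂ _+_ (markedPaths-diagonal s h) (k>n⇒nCk≡0 (s≤s (m≤n+m s h)))) (+-identityʳ _)
markedPaths-ballot (suc d) s (suc h) = begin
  markedPaths (suc n) s (suc h) + (suc d + suc n) C suc (suc h + suc n)
    ≡⟨ cong₂ (λ L′ i → markedPaths (suc n) s (suc h) + L′ C suc i) L+2 j+2 ⟩
  markedPaths (suc n) s (suc h) + (2 + L) C (3 + j)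
    ≡⟨ cong₂ _+_ (markedPaths-suc-suc n s h) (pascal² L (1 + j)) ⟩
  (M (2 + h) + M h + 2 * M (1 + h)) + (L C (1 + j) + 2 * (L C (2 + j)) + L C (3 + j))
    ≡⟨ regroup (M (2 + h)) (M h) (M (1 + h)) (L C (1 + j)) (L C (2 + j)) (L C (3 + j)) ⟩
  (M (2 + h) + L C (3 + j)) + (M h + L C (1 + j)) + 2 * (M (1 + h) + L C (2 + j))
    ≡⟨ cong₂ _+_ (cong₂ _+_ (markedPaths-ballot d s (2 + h)) (markedPaths-ballot d s h))
                 (cong (2 *_) (markedPaths-ballot d s (1 + h))) ⟩
  L C (2 + j) + L C j + 2 * (L C (1 + j))
    ≡⟨ regroup′ (L C j) (L C (1 + j)) (L C (2 + j)) ⟩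
  L C j + 2 * (L C (1 + j)) + L C (2 + j)
    ≡⟨ pascal² L j ⟨
  (2 + L) C (2 + j)
    ≡⟨ cong₂ _C_ L+2 j+2 ⟨
  (suc d + suc n) C (suc h + suc n) ∎
  where
  open ≡-Reasoning
  n = d + s
  L = d + n
  j = h + n
  M = markedPaths n s
  L+2 : suc d + suc n ≡ 2 + L
  L+2 = cong suc (+-suc d n)
  j+2 : suc h + suc n ≡ 2 + j
  j+2 = cong suc (+-suc h n)
  regroup : ∀ m₂ m₀ m₁ c₁ c₂ c₃ →
    (m₂ + m₀ + 2 * m₁) + (c₁ + 2 * c₂ + c₃) ≡ (m₂ + c₃) + (m₀ + c₁) + 2 * (m₁ + c₂)
  regroup = solve-∀
  regroup′ : ∀ c₀ c₁ c₂ → c₂ + c₀ + 2 * c₁ ≡ c₀ + 2 * c₁ + c₂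
  regroup′ = solve-∀
markedPaths-ballot (suc d) zero zero = begin
  markedPaths (suc n) 0 0 + (suc d + suc n) C (2 + n)
    ≡⟨ cong₂ _+_ (markedPaths-suc-0-0 n) (cong (_C (2 + n)) L+2) ⟩
  M 1 + M 0 + (2 + L) C (2 + n)
    ≡⟨ cong (λ v → M 1 + M 0 + v) (pascal² L n) ⟩
  M 1 + M 0 + (L C n + 2 * (L C (1 + n)) + L C (2 + n))
    ≡⟨ regroup (M 1) (M 0) (L C n) (L C (1 + n)) (L C (2 + n)) ⟩
  (M 1 + L C (2 + n)) + (M 0 + L C (1 + n)) + (L C n + L C (1 + n))
    ≡⟨ cong₂ _+_ (cong₂ _+_ (markedPaths-ballot d 0 1) (markedPaths-ballot d 0 0)) (pascal L n) ⟩
  L C (1 + n) + L C n + (1 + L) C (1 + n)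
    ≡⟨ cong (_+ (1 + L) C (1 + n)) (trans (+-comm (L C (1 + n)) (L C n)) (pascal L n)) ⟩
  (1 + L) C (1 + n) + (1 + L) C (1 + n)
    ≡⟨ cong (_+ (1 + L) C (1 + n)) (sym symmetric) ⟩
  (1 + L) C n + (1 + L) C (1 + n)
    ≡⟨ pascal (1 + L) n ⟩
  (2 + L) C (1 + n)
    ≡⟨ cong (_C (1 + n)) L+2 ⟨
  (suc d + suc n) C (1 + n) ∎
  where
  open ≡-Reasoning
  pascal = nCk+nC[k+1]≡[n+1]C[k+1]
  n = d + 0
  L = d + n
  M = markedPaths n 0
  L+2 : suc d + suc n ≡ 2 + L
  L+2 = cong suc (+-suc d n)
  -- Without marked steps there is no third recursive term; the symmetry of C(2d+1, ·) replaces it.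
  symmetric : (1 + L) C n ≡ (1 + L) C (1 + n)
  symmetric = subst (λ L′ → suc L′ C n ≡ suc L′ C suc n) (cong (_+ n) (+-identityʳ d)) (central-symmetry n)
  regroup : ∀ m₁ m₀ c₀ c₁ c₂ → m₁ + m₀ + (c₀ + 2 * c₁ + c₂) ≡ (m₁ + c₂) + (m₀ + c₁) + (c₀ + c₁)
  regroup = solve-∀
markedPaths-ballot (suc d) (suc s) zero = begin
  markedPaths (suc n) (suc s) 0 + (suc d + suc n) C (2 + n)
    ≡⟨ cong₂ _+_ (markedPaths-suc-suc-0 n s) (cong (_C (2 + n)) L+2) ⟩
  M 1 + M 0 + M′ + (2 + L) C (2 + n)
    ≡⟨ cong (λ v → M 1 + M 0 + M′ + v) expand ⟩
  M 1 + M 0 + M′ + ((1 + L) C (1 + n) + (L C (1 + n) + L C (2 + n)))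
    ≡⟨ regroup (M 1) (M 0) M′ ((1 + L) C (1 + n)) (L C (1 + n)) (L C (2 + n)) ⟩
  (M 1 + L C (2 + n)) + (M 0 + L C (1 + n)) + (M′ + (1 + L) C (1 + n))
    ≡⟨ cong₂ _+_ (cong₂ _+_ (markedPaths-ballot d (suc s) 1) (markedPaths-ballot d (suc s) 0)) shifted ⟩
  L C (1 + n) + L C n + (1 + L) C n
    ≡⟨ cong (_+ (1 + L) C n) (trans (+-comm (L C (1 + n)) (L C n)) (pascal L n)) ⟩
  (1 + L) C (1 + n) + (1 + L) C n
    ≡⟨ trans (+-comm ((1 + L) C (1 + n)) _) (pascal (1 + L) n) ⟩
  (2 + L) C (1 + n)
    ≡⟨ cong (_C (1 + n)) L+2 ⟨
  (suc d + suc n) C (1 + n) ∎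
  where
  open ≡-Reasoning
  pascal = nCk+nC[k+1]≡[n+1]C[k+1]
  n = d + suc s
  L = d + n
  M = markedPaths n (suc s)
  M′ = markedPaths n s 0
  L+2 : suc d + suc n ≡ 2 + L
  L+2 = cong suc (+-suc d n)
  expand : (2 + L) C (2 + n) ≡ (1 + L) C (1 + n) + (L C (1 + n) + L C (2 + n))
  expand = trans (sym (pascal (1 + L) (1 + n))) (cong (λ c → (1 + L) C (1 + n) + c) (sym (pascal L (1 + n))))
  shifted : M′ + (1 + L) C (1 + n) ≡ (1 + L) C n
  shifted = subst (λ m → markedPaths m s 0 + suc (d + m) C suc m ≡ suc (d + m) C m)
                  (sym (+-suc d s)) (markedPaths-ballot (suc d) s 0)
  regroup : ∀ m₁ m₀ m′ c c₁ c₂ → m₁ + m₀ + m′ + (c + (c₁ + c₂)) ≡ (m₁ + c₂) + (m₀ + c₁) + (m′ + c)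
  regroup = solve-∀

markedPaths-closedForm : ∀ {n s} → s ≤ n → suc n * markedPaths n s 0 ≡ suc s * ((2 * n ∸ s) C n)
markedPaths-closedForm {n} {s} s≤n = +-cancelʳ-≡ (d * X) _ _ (begin
  suc n * M + d * X                  ≡⟨ cong (λ v → suc n * M + v) (absorption-complement d n) ⟨
  suc n * M + suc n * (L C suc n)    ≡⟨ *-distribˡ-+ (suc n) M _ ⟨
  suc n * (M + L C suc n)            ≡⟨ cong (suc n *_) ballot ⟩
  suc n * X                          ≡⟨ cong (λ m → suc m * X) s+d≡n ⟨
  suc (s + d) * X                    ≡⟨ regroup s d X ⟩
  suc s * X + d * X                  ≡⟨ cong (λ L′ → suc s * (L′ C n) + d * X) L≡2n∸s ⟩
  suc s * ((2 * n ∸ s) C n) + d * X  ∎)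
  where
  open ≡-Reasoning
  d = proj₁ (m≤n⇒∃[o]m+o≡n s≤n)
  s+d≡n = proj₂ (m≤n⇒∃[o]m+o≡n s≤n)
  L = d + n
  M = markedPaths n s 0
  X = L C n
  ballot : M + L C suc n ≡ X
  ballot = subst (λ m → markedPaths m s 0 + (d + m) C suc m ≡ (d + m) C m)
                 (trans (+-comm d s) s+d≡n) (markedPaths-ballot d s 0)
  regroup : ∀ s d X → suc (s + d) * X ≡ suc s * X + d * X
  regroup = solve-∀
  L≡2n∸s : L ≡ 2 * n ∸ s
  L≡2n∸s = sym (trans (cong (_∸ s) (subst (λ m → 2 * m ≡ d + m + s) s+d≡n (arith s d))) (m+n∸n≡m L s))
    where
    arith : ∀ s d → 2 * (s + d) ≡ d + (s + d) + s
    arith = solve-∀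

noBroken0Paths≡markedPaths : ∀ n h → noBroken0Paths n h ≡ markedPaths n 0 h
noBroken0Paths≡markedPaths zero    zero    = refl
noBroken0Paths≡markedPaths zero    (suc h) = refl
noBroken0Paths≡markedPaths (suc n) zero    =
  trans (cong₂ _+_ (noBroken0Paths≡markedPaths n 1) (noBroken0Paths≡markedPaths n 0)) (sym (markedPaths-suc-0-0 n))
noBroken0Paths≡markedPaths (suc n) (suc h) =
  trans (cong₂ _+_ (cong₂ _+_ (noBroken0Paths≡markedPaths n (2 + h)) (noBroken0Paths≡markedPaths n h))
                   (cong (2 *_) (noBroken0Paths≡markedPaths n (1 + h))))
        (sym (markedPaths-suc-suc n 0 h))

catalan≡noBroken0Paths : ∀ n → catalan n ≡ noBroken0Paths n 0
catalan≡noBroken0Paths n = begin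
  ((2 * n) C n) / suc n                ≡⟨ cong (_/ suc n) central ⟩
  (noBroken0Paths n 0 * suc n) / suc n ≡⟨ m*n/n≡m (noBroken0Paths n 0) (suc n) ⟩
  noBroken0Paths n 0                   ∎
  where
  open ≡-Reasoning
  central : (2 * n) C n ≡ noBroken0Paths n 0 * suc n
  central = begin
    (2 * n) C n                    ≡⟨ *-identityˡ _ ⟨
    1 * ((2 * n) C n)              ≡⟨ markedPaths-closedForm {n} z≤n ⟨
    suc n * markedPaths n 0 0      ≡⟨ *-comm (suc n) _ ⟩
    markedPaths n 0 0 * suc n      ≡⟨ cong (_* suc n) (noBroken0Paths≡markedPaths n 0) ⟨
    noBroken0Paths n 0 * suc n     ∎

fromℤ : ℤ → ℚ
fromℤ z = z ℚ./ 1

private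
  toℚᵘ-fromℤ : ∀ z → ℚ.toℚᵘ (fromℤ z) ℚᵘ.≃ ℚᵘ.mkℚᵘ z 0
  toℚᵘ-fromℤ z = ℚ.toℚᵘ-fromℚᵘ (ℚᵘ.mkℚᵘ z 0)

fromℤ-+ : ∀ a b → fromℤ (a ℤ.+ b) ≡ fromℤ a ℚ.+ fromℤ b
fromℤ-+ a b = ℚ.toℚᵘ-injective (begin
  ℚ.toℚᵘ (fromℤ (a ℤ.+ b))                    ≈⟨ toℚᵘ-fromℤ (a ℤ.+ b) ⟩
  ℚᵘ.mkℚᵘ (a ℤ.+ b) 0                      ≈⟨ ℚᵘ.*≡* (cross a b) ⟩
  ℚᵘ.mkℚᵘ a 0 ℚᵘ.+ ℚᵘ.mkℚᵘ b 0             ≈⟨ ℚᵘ.+-cong (toℚᵘ-fromℤ a) (toℚᵘ-fromℤ b) ⟨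
  ℚ.toℚᵘ (fromℤ a) ℚᵘ.+ ℚ.toℚᵘ (fromℤ b)           ≈⟨ ℚ.toℚᵘ-homo-+ (fromℤ a) (fromℤ b) ⟨
  ℚ.toℚᵘ (fromℤ a ℚ.+ fromℤ b)                     ∎)
  where
  open ℚᵘ.≃-Reasoning
  cross : ∀ a b → (a ℤ.+ b) ℤ.* + 1 ≡ (a ℤ.* + 1 ℤ.+ b ℤ.* + 1) ℤ.* + 1
  cross = ℤ-Solver.solve-∀

fromℤ-* : ∀ a b → fromℤ (a ℤ.* b) ≡ fromℤ a ℚ.* fromℤ b
fromℤ-* a b = ℚ.toℚᵘ-injective (begin
  ℚ.toℚᵘ (fromℤ (a ℤ.* b))                    ≈⟨ toℚᵘ-fromℤ (a ℤ.* b) ⟩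
  ℚᵘ.mkℚᵘ (a ℤ.* b) 0                      ≈⟨ ℚᵘ.≃-refl ⟩
  ℚᵘ.mkℚᵘ a 0 ℚᵘ.* ℚᵘ.mkℚᵘ b 0             ≈⟨ ℚᵘ.*-cong (toℚᵘ-fromℤ a) (toℚᵘ-fromℤ b) ⟨
  ℚ.toℚᵘ (fromℤ a) ℚᵘ.* ℚ.toℚᵘ (fromℤ b)           ≈⟨ ℚ.toℚᵘ-homo-* (fromℤ a) (fromℤ b) ⟨
  ℚ.toℚᵘ (fromℤ a ℚ.* fromℤ b)                     ∎)
  where open ℚᵘ.≃-Reasoning

fromℤ-/ : ∀ {n N c z} → suc n * N ≡ c * z → fromℤ (+ N) ≡ (+ c ℚ./ suc n) ℚ.* fromℤ (+ z)
fromℤ-/ {n} {N} {c} {z} e = ℚ.toℚᵘ-injective (begin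
  ℚ.toℚᵘ (fromℤ (+ N))                                 ≈⟨ toℚᵘ-fromℤ (+ N) ⟩
  ℚᵘ.mkℚᵘ (+ N) 0                                   ≈⟨ ℚᵘ.*≡* cross ⟩
  ℚᵘ.mkℚᵘ (+ c) n ℚᵘ.* ℚᵘ.mkℚᵘ (+ z) 0              ≈⟨ ℚᵘ.*-cong (ℚ.toℚᵘ-fromℚᵘ (ℚᵘ.mkℚᵘ (+ c) n)) (toℚᵘ-fromℤ (+ z)) ⟨
  ℚ.toℚᵘ (+ c ℚ./ suc n) ℚᵘ.* ℚ.toℚᵘ (fromℤ (+ z))      ≈⟨ ℚ.toℚᵘ-homo-* (+ c ℚ./ suc n) (fromℤ (+ z)) ⟨
  ℚ.toℚᵘ ((+ c ℚ./ suc n) ℚ.* fromℤ (+ z))              ∎)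
  where
  open ℚᵘ.≃-Reasoning
  cross : + N ℤ.* + suc (n * 1) ≡ + c ℤ.* + z ℤ.* + 1
  cross = trans (sym (ℤ.pos-* N (suc (n * 1))))
          (trans (cong +_ (trans (cong (λ m → N * suc m) (*-identityʳ n)) (trans (*-comm N (suc n)) e)))
          (trans (ℤ.pos-* c z) (sym (ℤ.*-identityʳ (+ c ℤ.* + z)))))

fromℤ-∑≤ : ∀ M f → fromℤ (ℤΣ.∑≤ M f) ≡ sumℚ M (λ i → fromℤ (f i))
fromℤ-∑≤ zero    f = refl
fromℤ-∑≤ (suc M) f = trans (fromℤ-+ (ℤΣ.∑≤ M f) (f (suc M))) (cong (ℚ._+ fromℤ (f (suc M))) (fromℤ-∑≤ M f))

sumℚ-cong : ∀ M {f g} → (∀ i → i ≤ M → f i ≡ g i) → sumℚ M f ≡ sumℚ M g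
sumℚ-cong zero    f≡g = f≡g 0 z≤n
sumℚ-cong (suc M) f≡g = cong₂ ℚ._+_ (sumℚ-cong M λ i i≤M → f≡g i (m≤n⇒m≤1+n i≤M)) (f≡g (suc M) ≤-refl)

pos-∑≤ : ∀ N f → + ∑≤ N f ≡ ℤΣ.∑≤ N (λ i → + f i)
pos-∑≤ zero    f = refl
pos-∑≤ (suc N) f = trans (ℤ.pos-+ (∑≤ N f) (f (suc N))) (cong (ℤ._+ + f (suc N)) (pos-∑≤ N f))

solid0Paths-inversion : ∀ k M →
  + solid0Paths (k + M) k 0 ≡ ℤΣ.∑≤ M (λ i → -1^ i ℤ.* + markedPaths (k + M) (k + i) 0 ℤ.* + ((k + i) C k))
solid0Paths-inversion k M = sym (trans (ℤΣ.∑≤-cong M λ i _ → cong (λ m → -1^ i ℤ.* m ℤ.* + ((k + i) C k)) (cast (k + i)))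
                                      (binomial-inversion k M (λ j → + solid0Paths n j 0)))
  where
  n = k + M
  cast : ∀ s → + markedPaths n s 0 ≡ ℤΣ.∑≤ n (λ j → + (j C s) ℤ.* + solid0Paths n j 0)
  cast s = trans (pos-∑≤ n _) (ℤΣ.∑≤-cong n λ j _ → ℤ.pos-* (j C s) _)

mnk-term : ℕ → ℕ → ℕ → ℚ
mnk-term n k i = ((ℤ.- (+ 1)) ℤ.^ i) ℚ./ 1
    ℚ.* ((+ (k + 1 + i)) ℚ./ suc n)
    ℚ.* ℕtoℚ ((2 * n ∸ k ∸ i) C n)
    ℚ.* ℕtoℚ ((k + i) C k)

fromℤ-inversion-term : ∀ {n} k i → k + i ≤ n →
  fromℤ (-1^ i ℤ.* + markedPaths n (k + i) 0 ℤ.* + ((k + i) C k)) ≡ mnk-term n k i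
fromℤ-inversion-term {n} k i k+i≤n = begin
  fromℤ (-1^ i ℤ.* + markedPaths n (k + i) 0 ℤ.* + ((k + i) C k))
    ≡⟨ trans (fromℤ-* (-1^ i ℤ.* + marked) _) (cong (ℚ._* fromℤ (+ ((k + i) C k))) (fromℤ-* (-1^ i) (+ marked))) ⟩
  fromℤ (-1^ i) ℚ.* fromℤ (+ markedPaths n (k + i) 0) ℚ.* ℕtoℚ ((k + i) C k)
    ≡⟨ cong (λ q → fromℤ (-1^ i) ℚ.* q ℚ.* ℕtoℚ ((k + i) C k)) (fromℤ-/ {n} {marked} {k + 1 + i} {binom} closedForm) ⟩
  fromℤ (-1^ i) ℚ.* ((+ (k + 1 + i)) ℚ./ suc n ℚ.* ℕtoℚ binom) ℚ.* ℕtoℚ ((k + i) C k)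
    ≡⟨ cong (ℚ._* ℕtoℚ ((k + i) C k)) (ℚ.*-assoc (fromℤ (-1^ i)) _ (ℕtoℚ binom)) ⟨
  mnk-term n k i ∎
  where
  open ≡-Reasoning
  marked = markedPaths n (k + i) 0
  binom = (2 * n ∸ k ∸ i) C n
  closedForm : suc n * markedPaths n (k + i) 0 ≡ (k + 1 + i) * binom
  closedForm = trans (markedPaths-closedForm k+i≤n)
    (cong₂ (λ a L → a * (L C n)) (trans (sym (+-suc k i)) (sym (+-assoc k 1 i))) (sym (∸-+-assoc (2 * n) k i)))

countWords-noBroken0Solid : ∀ n k → k ≤ n → ℕtoℚ (countWords n (noBroken0Solid k)) ≡ mnk n k
countWords-noBroken0Solid n k k≤n with M , refl ← m≤n⇒∃[o]m+o≡n k≤n = begin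
  ℕtoℚ (countWords (k + M) (noBroken0SolidFrom k 0))  ≡⟨ cong ℕtoℚ (countWords-noBroken0SolidFrom (k + M) k 0) ⟩
  fromℤ (+ solid0Paths (k + M) k 0)                    ≡⟨ cong fromℤ (solid0Paths-inversion k M) ⟩
  fromℤ (ℤΣ.∑≤ M _)                                    ≡⟨ fromℤ-∑≤ M _ ⟩
  sumℚ M _                                             ≡⟨ sumℚ-cong M (λ i i≤M → fromℤ-inversion-term k i (+-monoʳ-≤ k i≤M)) ⟩
  sumℚ M (mnk-term (k + M) k)                          ≡⟨ cong (λ m → sumℚ m (mnk-term (k + M) k)) (m+n∸m≡n k M) ⟨
  mnk (k + M) k                                        ∎
  where open ≡-Reasoning

countWords-noBroken0 : ∀ n → countWords n noBroken0 ≡ catalan n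
countWords-noBroken0 n = trans (countWords-noBroken0From n 0) (sym (catalan≡noBroken0Paths n))

countWords-noHoriz0 : ∀ n (F : ℕ → ℕ) → F 0 ≡ 1 → (∀ m → F m + 2 * F (suc m) ≡ catalan (suc m)) →
  countWords n noHoriz0 ≡ F n
countWords-noHoriz0 n F F₀ F-step = begin
  countWords n noHoriz0                     ≡⟨ countWords-cong n noHoriz0≗noBroken0SolidFrom ⟩
  countWords n (noBroken0SolidFrom 0 0)     ≡⟨ countWords-noBroken0SolidFrom n 0 0 ⟩
  solid0Paths n 0 0                         ≡⟨ recurrence-unique (λ m → solid0Paths m 0 0) F (sym F₀) fine n ⟩
  F n                                       ∎
  where
  open ≡-Reasoning
  fine : ∀ m → solid0Paths m 0 0 + 2 * solid0Paths (suc m) 0 0 ≡ F m + 2 * F (suc m)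
  fine m = begin
    solid0Paths m 0 0 + 2 * solid0Paths (suc m) 0 0  ≡⟨ solid0Paths-fineRelation m 0 ⟩
    noBroken0Paths (suc m) 0 + 0                     ≡⟨ +-identityʳ _ ⟩
    noBroken0Paths (suc m) 0                         ≡⟨ catalan≡noBroken0Paths (suc m) ⟨
    catalan (suc m)                                  ≡⟨ F-step m ⟨
    F m + 2 * F (suc m)                              ∎

corollary4p9 : (n : ℕ) → 1 ≤ n →
    (countWords n noBroken0 ≡ catalan n)
    × ((F : ℕ → ℕ) → F 0 ≡ 1 → ((m : ℕ) → F m + 2 * F (suc m) ≡ catalan (suc m)) →
        countWords n noHoriz0 ≡ F n)
    × ((k : ℕ) → k ≤ n → ℕtoℚ (countWords n (noBroken0Solid k)) ≡ mnk n k)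
corollary4p9 n _ = countWords-noBroken0 n , countWords-noHoriz0 n , countWords-noBroken0Solid n
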